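{- Let $P=(I_1,\dots,I_t)$ be a URM program and let $G=(N,E,q_1,q_{t+1})$ be the basic affine control flow graph obtained from $P$ by the translation $\tau$, with start node $q_1$ and end node $q_{t+1}$. Then for all $\vec x\in\mathbb{N}^{k_P}$: if for all $\vec x'\in\mathbb{N}^{k_P}$ and all $n\in\mathbb{N}$ it is not the case that $\langle\vec x,1\rangle\Rightarrow^n\langle\vec x',t+1\rangle$, then $[\![G]\!]_{\vec x:0}[q_{t+1}]=\varnothing$.
   Context: URMs (Cutland): a program is a sequence $P=(I_1,\dots,I_t)$ of instructions $z(n)$ ($r_n\leftarrow0$), $s(n)$ ($r_n\leftarrow r_n+1$), $t(m,n)$ ($r_n\leftarrow r_m$), each moving to the next instruction, and $j(m,n,p)$ (jump to $I_p$ if $r_m=r_n$, else go to the next instruction), with jump targets $p\in\{1,\dots,t+1\}$. $k_P$ is the largest register index used by $P$. Configurations are $\langle\vec x,c\rangle\in\mathbb{N}^{k_P}\times\mathbb{N}$, $\Rightarrow$ is the one-step transition relation on configurations with $1\le c\le t$, $\Rightarrow^n$ its $n$-fold iterate, and $P$ halts on reaching a configuration $\langle\vec x,t+1\rangle$. BACFGs: $G=(N,E,s,e)$ with finite node set $N$, start/end nodes, edges $E\subseteq N\times\mathrm{Com}\times N$ labelled by assignments $x_i:=0$, $x_i:=x_j$, $x_i:=x_j+1$ or guards $x_i=x_j?$, $x_i=v?$; states are tuples in $\mathbb{N}^k$, $k$ the number of variables. Transfer functions $f_c$ on $\wp(\mathbb{N}^k)$ apply the assignment to every state, resp. keep the states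 satisfying the guard. For $S\subseteq\mathbb{N}^{k'}$, $S\restriction_k$ is $S\times\mathbb{N}^{k-k'}$ if $k'<k$, $S$ if $k'=k$, and the set of projections onto the first $k$ coordinates if $k<k'$. The collecting semantics $[\![G]\!]_S:N\to\wp(\mathbb{N}^k)$ is the least (pointwise inclusion) assignment satisfying $[\![G]\!]_S[s]\supseteq S\restriction_k$ and $[\![G]\!]_S[v]\supseteq f_c([\![G]\!]_S[u])$ for every edge $(u,c,v)\in E$; $[\![G]\!]_{\vec x}=[\![G]\!]_{\{\vec x\}}$, and $\vec x:0$ denotes $\vec x$ with a $0$ appended. Translation $\tau$: nodes $q_1,\dots,q_{t+1}$; let $z$ denote the variable $x_{k_P+1}$; for $I_i=z(n)$ add edge $(q_i,x_n:=0,q_{i+1})$; for $I_i=s(n)$ add $(q_i,x_n:=x_n+1,q_{i+1})$; for $I_i=t(m,n)$ add $(q_i,x_n:=x_m,q_{i+1})$; for $I_i=j(m,n,p)$ add a new node $inc_i$ and edges $(q_i,x_m=x_n?,q_p)$, $(q_i,z:=x_m+1,inc_i)$, $(q_i,z:=x_n+1,inc_i)$, $(inc_i,z:=z+1,inc_i)$, $(inc_i,x_n=z?,q_{i+1})$, $(inc_i,x_m=z?,q_{i+1})$. The resulting graph has $k_P+1$ variables. -}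

module Defs where

open import Data.Nat using (ℕ; zero; suc; _+_; _≤_; _<_; _⊔_)
open import Data.List using (List; []; _∷_; length; foldr; _++_; concat; map; upTo)
open import Data.List.Membership.Propositional using (_∈_)
open import Data.List.Relation.Unary.All using (All)
open import Data.Vec using (Vec; []; _∷_)
open import Data.Maybe using (Maybe; just; nothing)
open import Data.Product using (Σ; _×_; _,_; ∃)
open import Relation.Binary.PropositionalEquality using (_≡_)
open import Relation.Nullary using (¬_)

-- Register vectors / states, accessed with 1-based indices
-- (register r_n resp. variable x_n is component n, n ≥ 1).
-- Out-of-range accesses (never occurring for well-formed programs)
-- read 0 and write nothing.

get : ∀ {k} → Vec ℕ k → ℕ → ℕ
get []      _             = 0
get (a ∷ v) zero          = 0
get (a ∷ v) (suc zero)    = a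
get (a ∷ v) (suc (suc n)) = get v (suc n)

set : ∀ {k} → Vec ℕ k → ℕ → ℕ → Vec ℕ k
set []      _             b = []
set (a ∷ v) zero          b = a ∷ v
set (a ∷ v) (suc zero)    b = b ∷ v
set (a ∷ v) (suc (suc n)) b = a ∷ set v (suc n) b

data Instr : Set where
  zI : ℕ → Instr
  sI : ℕ → Instr
  tI : ℕ → ℕ → Instr
  jI : ℕ → ℕ → ℕ → Instr

Program : Set
Program = List Instr

maxReg : Instr → ℕ
maxReg (zI n)     = n
maxReg (sI n)     = n
maxReg (tI m n)   = m ⊔ n
maxReg (jI m n p) = m ⊔ n

kP : Program → ℕ
kP P = foldr (λ i r → maxReg i ⊔ r) 0 P

WFInstr : ℕ → Instr → Set
WFInstr t (zI n)     = 1 ≤ n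
WFInstr t (sI n)     = 1 ≤ n
WFInstr t (tI m n)   = 1 ≤ m × 1 ≤ n
WFInstr t (jI m n p) = 1 ≤ m × 1 ≤ n × 1 ≤ p × p ≤ suc t

WF : Program → Set
WF P = All (WFInstr (length P)) P

-- I_c (1-based); nothing if c = 0 or c > t
instrAt : Program → ℕ → Maybe Instr
instrAt []      _             = nothing
instrAt (i ∷ P) zero          = nothing
instrAt (i ∷ P) (suc zero)    = just i
instrAt (i ∷ P) (suc (suc c)) = instrAt P (suc c)

Config : Program → Set
Config P = Vec ℕ (kP P) × ℕ

data Step (P : Program) : Config P → Config P → Set where
  stepZ : ∀ {x c n} → instrAt P c ≡ just (zI n) →
          Step P (x , c) (set x n 0 , suc c)
  stepS : ∀ {x c n} → instrAt P c ≡ just (sI n) →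
          Step P (x , c) (set x n (suc (get x n)) , suc c)
  stepT : ∀ {x c m n} → instrAt P c ≡ just (tI m n) →
          Step P (x , c) (set x n (get x m) , suc c)
  stepJyes : ∀ {x c m n p} → instrAt P c ≡ just (jI m n p) →
          get x m ≡ get x n → Step P (x , c) (x , p)
  stepJno : ∀ {x c m n p} → instrAt P c ≡ just (jI m n p) →
          ¬ (get x m ≡ get x n) → Step P (x , c) (x , suc c)

Steps : (P : Program) → ℕ → Config P → Config P → Set
Steps P zero    a b = a ≡ b
Steps P (suc n) a b = ∃ λ c → Step P a c × Steps P n c b

data Com : Set where
  assign0    : ℕ → Com
  assignCopy : ℕ → ℕ → Com
  assignSucc : ℕ → ℕ → Com
  guardEq    : ℕ → ℕ → Com
  guardConst : ℕ → ℕ → Com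

record BACFG (Node : Set) : Set where
  field
    vars  : ℕ
    nodes : List Node
    edges : List (Node × Com × Node)
    start : Node
    end   : Node
open BACFG public

-- σ' ∈ f_c({σ}); f_c(S) = ⋃_{σ∈S} f_c({σ})
Transfer : ∀ {k} → Com → Vec ℕ k → Vec ℕ k → Set
Transfer (assign0 i)      σ σ' = σ' ≡ set σ i 0
Transfer (assignCopy i j) σ σ' = σ' ≡ set σ i (get σ j)
Transfer (assignSucc i j) σ σ' = σ' ≡ set σ i (suc (get σ j))
Transfer (guardEq i j)    σ σ' = σ' ≡ σ × get σ i ≡ get σ j
Transfer (guardConst i v) σ σ' = σ' ≡ σ × get σ i ≡ v

-- S↾k : states σ ∈ ℕ^k agreeing on the first min(k,k') coordinates with
-- some element of S (this is S × ℕ^{k-k'}, S, or the projections of S)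
Restrict : ∀ {k'} → (Vec ℕ k' → Set) → (k : ℕ) → Vec ℕ k → Set
Restrict {k'} S k σ = Σ (Vec ℕ k') λ τ → S τ ×
  (∀ i → 1 ≤ i → i ≤ k → i ≤ k' → get τ i ≡ get σ i)

-- collecting semantics [[G]]_S, the least solution of the inclusions,
-- as an inductive family: Coll G S v σ  ⇔  σ ∈ [[G]]_S[v]
data Coll {Node : Set} (G : BACFG Node) {k' : ℕ} (S : Vec ℕ k' → Set)
     : Node → Vec ℕ (vars G) → Set where
  init : ∀ {σ} → Restrict S (vars G) σ → Coll G S (start G) σ
  edge : ∀ {u c v σ σ'} → (u , c , v) ∈ edges G →
         Coll G S u σ → Transfer c σ σ' → Coll G S v σ'

data Node : Set where
  q   : ℕ → Node
  inc : ℕ → Node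

-- edges for instruction I_i; zv is the index of the fresh variable z
instrEdges : ℕ → ℕ → Instr → List (Node × Com × Node)
instrEdges zv i (zI n)     = (q i , assign0 n , q (suc i)) ∷ []
instrEdges zv i (sI n)     = (q i , assignSucc n n , q (suc i)) ∷ []
instrEdges zv i (tI m n)   = (q i , assignCopy n m , q (suc i)) ∷ []
instrEdges zv i (jI m n p) =
  (q i , guardEq m n , q p) ∷
  (q i , assignSucc zv m , inc i) ∷
  (q i , assignSucc zv n , inc i) ∷
  (inc i , assignSucc zv zv , inc i) ∷
  (inc i , guardEq n zv , q (suc i)) ∷
  (inc i , guardEq m zv , q (suc i)) ∷ []

instrNodes : ℕ → Instr → List Node
instrNodes i (jI m n p) = inc i ∷ []
instrNodes i _         = []

indexed : ℕ → Program → List (ℕ × Instr)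
indexed i []      = []
indexed i (x ∷ P) = (i , x) ∷ indexed (suc i) P

τ : Program → BACFG Node
τ P = record
  { vars  = suc (kP P)
  ; nodes = map (λ i → q (suc i)) (upTo (suc (length P)))
            ++ concat (map (λ { (i , I) → instrNodes i I }) (indexed 1 P))
  ; edges = concat (map (λ { (i , I) → instrEdges (suc (kP P)) i I }) (indexed 1 P))
  ; start = q 1
  ; end   = q (suc (length P))
  }

module Submission where

open import Defs
open import Data.Nat using (ℕ; zero; suc; _+_; _≤_; _<_; z≤n; s≤s)
open import Data.Nat.Properties using (≤-trans; n<1+n; m≤n⇒m≤1+n; <⇒≢; m⊔n≤o⇒m≤o; m⊔n≤o⇒n≤o; m≤m⊔n; m≤n⊔m; +-suc; +-identityʳ)
open import Data.List using (_∷_; length; map)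
open import Data.List.Membership.Propositional using (_∈_)
open import Data.List.Membership.Propositional.Properties using (∈-concat⁻′; ∈-map⁻)
open import Data.List.Relation.Unary.Any using (here; there)
open import Data.Vec using (Vec; []; _∷_; _∷ʳ_)
import Data.Vec as Vec
open import Data.Vec.Properties using (init-∷ʳ)
open import Data.Maybe using (just)
open import Data.Product using (∃; _×_; _,_; proj₁; proj₂)
open import Data.Sum using (_⊎_; inj₁; inj₂; [_,_])
import Data.Sum as Sum
open import Function using (id; _∘_)
open import Relation.Binary.PropositionalEquality
  using (_≡_; _≢_; refl; sym; trans; cong; cong₂; subst; subst₂; module ≡-Reasoning)
open import Relation.Nullary using (¬_)

-- Every state that the collecting semantics of τ P gathers at q c is, with
-- the auxiliary variable z dropped, a register vector the URM reaches at
-- instruction c.  At inc i (instruction i = j(m,n,p)) the registers are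
-- additionally reachable at i and z exceeds r_m or r_n; z only grows while
-- the registers stay fixed, so an exit guard r_n = z or r_m = z can only
-- fire when r_m ≠ r_n, which is exactly the fall-through step of the URM.
-- Hence a state at q (t+1) yields a halting computation.

get-init : ∀ {k} (σ : Vec ℕ (suc k)) i → i ≤ k → get (Vec.init σ) i ≡ get σ i
get-init {zero}  (a ∷ []) zero          _         = refl
get-init {suc k} (a ∷ σ)  zero          _         = refl
get-init {suc k} (a ∷ σ)  (suc zero)    _         = refl
get-init {suc k} (a ∷ σ)  (suc (suc i)) (s≤s i≤k) = get-init σ (suc i) i≤k

init-set : ∀ {k} (σ : Vec ℕ (suc k)) i b → i ≤ k → Vec.init (set σ i b) ≡ set (Vec.init σ) i b
init-set {zero}  (a ∷ []) zero          b _         = refl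
init-set {suc k} (a ∷ σ)  zero          b _         = refl
init-set {suc k} (a ∷ σ)  (suc zero)    b _         = refl
init-set {suc k} (a ∷ σ)  (suc (suc i)) b (s≤s i≤k) = cong (a ∷_) (init-set σ (suc i) b i≤k)

init-set-last : ∀ {k} (σ : Vec ℕ (suc k)) b → Vec.init (set σ (suc k) b) ≡ Vec.init σ
init-set-last {zero}  (a ∷ []) b = refl
init-set-last {suc k} (a ∷ σ)  b = cong (a ∷_) (init-set-last σ b)

get-set-last : ∀ {k} (σ : Vec ℕ (suc k)) b → get (set σ (suc k) b) (suc k) ≡ b
get-set-last {zero}  (a ∷ []) b = refl
get-set-last {suc k} (a ∷ σ)  b = get-set-last σ b

get-set-last-≤ : ∀ {k} (σ : Vec ℕ (suc k)) b i → i ≤ k → get (set σ (suc k) b) i ≡ get σ i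
get-set-last-≤ {k} σ b i i≤k = begin
  get (set σ (suc k) b) i             ≡⟨ sym (get-init (set σ (suc k) b) i i≤k) ⟩
  get (Vec.init (set σ (suc k) b)) i  ≡⟨ cong (λ v → get v i) (init-set-last σ b) ⟩
  get (Vec.init σ) i                  ≡⟨ get-init σ i i≤k ⟩
  get σ i                             ∎
  where open ≡-Reasoning

get-extensionality : ∀ {k} (u v : Vec ℕ k) → (∀ i → 1 ≤ i → i ≤ k → get u i ≡ get v i) → u ≡ v
get-extensionality []      []      _ = refl
get-extensionality (a ∷ u) (b ∷ v) h =
  cong₂ _∷_ (h 1 (s≤s z≤n) (s≤s z≤n))
    (get-extensionality u v λ { (suc i) _ (s≤s i≤k) → h (suc (suc i)) (s≤s z≤n) (s≤s (s≤s i≤k)) })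

maxReg≤kP : ∀ P c {I} → instrAt P c ≡ just I → maxReg I ≤ kP P
maxReg≤kP (J ∷ P) (suc zero)    refl = m≤m⊔n (maxReg J) (kP P)
maxReg≤kP (J ∷ P) (suc (suc c)) eq   = ≤-trans (maxReg≤kP P (suc c) eq) (m≤n⊔m (maxReg J) (kP P))

jump-registers≤kP : ∀ P {c m n p} → instrAt P c ≡ just (jI m n p) → m ≤ kP P × n ≤ kP P
jump-registers≤kP P {c} {m} {n} eq = m⊔n≤o⇒m≤o m n bound , m⊔n≤o⇒n≤o m n bound
  where bound = maxReg≤kP P c eq

∈-indexed : ∀ j P {i I} → (i , I) ∈ indexed (suc j) P →
  ∃ λ d → i ≡ suc (j + d) × instrAt P (suc d) ≡ just I
∈-indexed j (J ∷ P) (here refl) = 0 , cong suc (sym (+-identityʳ j)) , refl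
∈-indexed j (J ∷ P) (there mem) with ∈-indexed (suc j) P mem
... | d , refl , eq = suc d , cong suc (sym (+-suc j d)) , eq

data TauEdge (P : Program) : Node → Com → Node → Set where
  zeroEdge : ∀ {i n} → instrAt P i ≡ just (zI n) →
    TauEdge P (q i) (assign0 n) (q (suc i))
  succEdge : ∀ {i n} → instrAt P i ≡ just (sI n) →
    TauEdge P (q i) (assignSucc n n) (q (suc i))
  copyEdge : ∀ {i m n} → instrAt P i ≡ just (tI m n) →
    TauEdge P (q i) (assignCopy n m) (q (suc i))
  jumpEdge : ∀ {i m n p} → instrAt P i ≡ just (jI m n p) →
    TauEdge P (q i) (guardEq m n) (q p)
  loadᵐEdge : ∀ {i m n p} → instrAt P i ≡ just (jI m n p) →
    TauEdge P (q i) (assignSucc (suc (kP P)) m) (inc i)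
  loadⁿEdge : ∀ {i m n p} → instrAt P i ≡ just (jI m n p) →
    TauEdge P (q i) (assignSucc (suc (kP P)) n) (inc i)
  countEdge : ∀ {i m n p} → instrAt P i ≡ just (jI m n p) →
    TauEdge P (inc i) (assignSucc (suc (kP P)) (suc (kP P))) (inc i)
  exitⁿEdge : ∀ {i m n p} → instrAt P i ≡ just (jI m n p) →
    TauEdge P (inc i) (guardEq n (suc (kP P))) (q (suc i))
  exitᵐEdge : ∀ {i m n p} → instrAt P i ≡ just (jI m n p) →
    TauEdge P (inc i) (guardEq m (suc (kP P))) (q (suc i))

instrEdges⇒TauEdge : ∀ P i {I u c v} → instrAt P i ≡ just I →
  (u , c , v) ∈ instrEdges (suc (kP P)) i I → TauEdge P u c v
instrEdges⇒TauEdge P i {zI n}     eq (here refl) = zeroEdge eq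
instrEdges⇒TauEdge P i {sI n}     eq (here refl) = succEdge eq
instrEdges⇒TauEdge P i {tI m n}   eq (here refl) = copyEdge eq
instrEdges⇒TauEdge P i {jI m n p} eq (here refl) = jumpEdge eq
instrEdges⇒TauEdge P i {jI m n p} eq (there (here refl)) = loadᵐEdge eq
instrEdges⇒TauEdge P i {jI m n p} eq (there (there (here refl))) = loadⁿEdge eq
instrEdges⇒TauEdge P i {jI m n p} eq (there (there (there (here refl)))) = countEdge eq
instrEdges⇒TauEdge P i {jI m n p} eq (there (there (there (there (here refl))))) = exitⁿEdge eq
instrEdges⇒TauEdge P i {jI m n p} eq (there (there (there (there (there (here refl)))))) = exitᵐEdge eq

τ-edge : ∀ P {u c v} → (u , c , v) ∈ edges (τ P) → TauEdge P u c v
τ-edge P mem with ∈-concat⁻′ (map _ (indexed 1 P)) mem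
... | _ , mem₁ , mem₂ with ∈-map⁻ _ mem₂
... | (i , I) , memᵢ , refl with ∈-indexed 0 P memᵢ
... | d , refl , eq = instrEdges⇒TauEdge P (suc d) eq mem₁

Steps-snoc : ∀ P n {a b c} → Steps P n a b → Step P b c → Steps P (suc n) a c
Steps-snoc P zero    refl                step = _ , step , refl
Steps-snoc P (suc n) (a′ , first , rest) step = a′ , first , Steps-snoc P n rest step

module Soundness (P : Program) (x : Vec ℕ (kP P)) where

  private
    k = kP P
    z = suc k

  Reachable : ℕ → Vec ℕ k → Set
  Reachable c y = ∃ λ n → Steps P n (x , 1) (y , c)

  reachable-step : ∀ {c c′ y y′} → Reachable c y → Step P (y , c) (y′ , c′) → Reachable c′ y′
  reachable-step (n , run) step = suc n , Steps-snoc P n run step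

  CounterAbove : Vec ℕ (suc k) → ℕ → ℕ → Set
  CounterAbove σ m n = get σ m < get σ z ⊎ get σ n < get σ z

  record Counting (i : ℕ) (σ : Vec ℕ (suc k)) : Set where
    field
      {m n p}   : ℕ
      jump      : instrAt P i ≡ just (jI m n p)
      reachable : Reachable i (Vec.init σ)
      above     : CounterAbove σ m n

  Invariant : Node → Vec ℕ (suc k) → Set
  Invariant (q c)   σ = Reachable c (Vec.init σ)
  Invariant (inc i) σ = Counting i σ

  reachable-set : ∀ {c} σ n b → n ≤ k → Reachable c (set (Vec.init σ) n b) → Reachable c (Vec.init (set σ n b))
  reachable-set σ n b n≤k = subst (Reachable _) (sym (init-set σ n b n≤k))

  reachable-set-counter : ∀ {c} σ b → Reachable c (Vec.init σ) → Reachable c (Vec.init (set σ z b))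
  reachable-set-counter σ b = subst (Reachable _) (sym (init-set-last σ b))

  below-counter-set : ∀ σ {r b} → r ≤ k → get σ r < b → get (set σ z b) r < get (set σ z b) z
  below-counter-set σ {r} {b} r≤k =
    subst₂ _<_ (sym (get-set-last-≤ σ b r r≤k)) (sym (get-set-last σ b))

  CounterAbove-count : ∀ σ {m n} → m ≤ k → n ≤ k →
    CounterAbove σ m n → CounterAbove (set σ z (suc (get σ z))) m n
  CounterAbove-count σ m≤k n≤k =
    Sum.map (below-counter-set σ m≤k ∘ m≤n⇒m≤1+n) (below-counter-set σ n≤k ∘ m≤n⇒m≤1+n)

  -- r_m = r_n would put both registers at z, yet one of them is below it.
  CounterAbove⇒≢ : ∀ σ {m n} → CounterAbove σ m n →
    get σ m ≡ get σ z ⊎ get σ n ≡ get σ z → get σ m ≢ get σ n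
  CounterAbove⇒≢ σ above hit eq =
    [ (λ lt → <⇒≢ lt atᵐ) , (λ lt → <⇒≢ lt atⁿ) ] above
    where
    atᵐ = [ id , trans eq ] hit
    atⁿ = [ trans (sym eq) , id ] hit

  Counting-exit : ∀ σ {i m n p} → instrAt P i ≡ just (jI m n p) → Counting i σ →
    get σ m ≡ get σ z ⊎ get σ n ≡ get σ z → Reachable (suc i) (Vec.init σ)
  Counting-exit σ eq counting hit with trans (sym eq) (Counting.jump counting)
  ... | refl = reachable-step reachable (stepJno eq unequal)
    where
    open Counting counting
    m≤k = proj₁ (jump-registers≤kP P eq)
    n≤k = proj₂ (jump-registers≤kP P eq)
    unequal : get (Vec.init σ) m ≢ get (Vec.init σ) n
    unequal e = CounterAbove⇒≢ σ above hit (trans (sym (get-init σ m m≤k)) (trans e (get-init σ n n≤k)))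

  Invariant-step : ∀ {u c v σ σ′} → TauEdge P u c v → Invariant u σ → Transfer c σ σ′ → Invariant v σ′
  Invariant-step {σ = σ} (zeroEdge {n = n} eq) r refl =
    reachable-set σ n 0 (maxReg≤kP P _ eq) (reachable-step r (stepZ eq))
  Invariant-step {σ = σ} (succEdge {n = n} eq) r refl =
    reachable-set σ n _ n≤k
      (subst (λ b → Reachable _ (set (Vec.init σ) n (suc b))) (get-init σ n n≤k) (reachable-step r (stepS eq)))
    where n≤k = maxReg≤kP P _ eq
  Invariant-step {σ = σ} (copyEdge {m = m} {n} eq) r refl =
    reachable-set σ n _ (m⊔n≤o⇒n≤o m n bound)
      (subst (λ b → Reachable _ (set (Vec.init σ) n b)) (get-init σ m (m⊔n≤o⇒m≤o m n bound)) (reachable-step r (stepT eq)))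
    where bound = maxReg≤kP P _ eq
  Invariant-step {σ = σ} (jumpEdge {m = m} {n} eq) r (refl , equal) =
    reachable-step r (stepJyes eq (trans (get-init σ m m≤k) (trans equal (sym (get-init σ n n≤k)))))
    where
    m≤k = proj₁ (jump-registers≤kP P eq)
    n≤k = proj₂ (jump-registers≤kP P eq)
  Invariant-step {σ = σ} (loadᵐEdge eq) r refl = record
    { jump      = eq
    ; reachable = reachable-set-counter σ _ r
    ; above     = inj₁ (below-counter-set σ (proj₁ (jump-registers≤kP P eq)) (n<1+n _))
    }
  Invariant-step {σ = σ} (loadⁿEdge eq) r refl = record
    { jump      = eq
    ; reachable = reachable-set-counter σ _ r
    ; above     = inj₂ (below-counter-set σ (proj₂ (jump-registers≤kP P eq)) (n<1+n _))
    }
  Invariant-step {σ = σ} (countEdge _) counting refl = record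
    { jump      = jump
    ; reachable = reachable-set-counter σ _ reachable
    ; above     = CounterAbove-count σ m≤k n≤k above
    }
    where
    open Counting counting
    m≤k = proj₁ (jump-registers≤kP P jump)
    n≤k = proj₂ (jump-registers≤kP P jump)
  Invariant-step {σ = σ} (exitⁿEdge eq) counting (refl , hit) = Counting-exit σ eq counting (inj₂ hit)
  Invariant-step {σ = σ} (exitᵐEdge eq) counting (refl , hit) = Counting-exit σ eq counting (inj₁ hit)

  Invariant-start : ∀ {σ} → Restrict (λ σ₀ → σ₀ ≡ x ∷ʳ 0) (suc k) σ → Invariant (q 1) σ
  Invariant-start {σ} (_ , refl , agree) = 0 , cong (_, 1) (sym (begin
    Vec.init σ          ≡⟨ cong Vec.init (sym initial≡σ) ⟩
    Vec.init (x ∷ʳ 0)   ≡⟨ init-∷ʳ 0 x ⟩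
    x                   ∎))
    where
    open ≡-Reasoning
    initial≡σ : x ∷ʳ 0 ≡ σ
    initial≡σ = get-extensionality (x ∷ʳ 0) σ λ i 1≤i i≤k → agree i 1≤i i≤k i≤k

  collected⇒Invariant : ∀ {v σ} → Coll (τ P) (λ σ₀ → σ₀ ≡ x ∷ʳ 0) v σ → Invariant v σ
  collected⇒Invariant (init start)              = Invariant-start start
  collected⇒Invariant (edge mem collected transfer) =
    Invariant-step (τ-edge P mem) (collected⇒Invariant collected) transfer

mainTheorem9 : (P : Program) → WF P → (x : Vec ℕ (kP P)) →
    (∀ (x' : Vec ℕ (kP P)) (n : ℕ) → ¬ Steps P n (x , 1) (x' , suc (length P))) →
    ∀ (σ : Vec ℕ (suc (kP P))) →
    ¬ Coll (τ P) (λ σ₀ → σ₀ ≡ x ∷ʳ 0) (end (τ P)) σ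
mainTheorem9 P _ x nonHalting σ collected =
  let n , run = Soundness.collected⇒Invariant P x collected
  in nonHalting (Vec.init σ) n run
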